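{- For all integers $i\geq1$ and $k\geq 1$, \begin{align*} u_{i+1}u_{i+2}^k u_{i+1}u_i &\equiv u_{i+1}u_{i+2}^k u_iu_{i+1}\pmod J,\\ u_{i+1}u_{i+2}u_i^k u_{i+1} &\equiv u_{i+2}u_{i+1}u_i^k u_{i+1}\pmod J. \end{align*}
   Context: $\mathcal U$ is the free associative $\mathbf C$-algebra on generators $u_1,u_2,\dots$. $J$ is the two-sided ideal of $\mathcal U$ generated by $u_iu_j-u_ju_i$ ($|i-j|\ge2$), $u_iu_{i+1}u_i-u_{i+1}u_iu_i$, $u_{i+1}u_{i+1}u_i-u_{i+1}u_iu_{i+1}$, and $u_{i+1}u_{i+2}u_{i+1}u_i-u_{i+1}u_{i+2}u_iu_{i+1}$ for all $i,j\ge1$. -}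

module Defs where

open import Level using (_⊔_)
open import Algebra.Bundles using (CommutativeRing)
open import Data.Nat using (ℕ; suc; pred; _≤_; ∣_-_∣)
open import Data.Nat.Properties using () renaming (_≟_ to _≟ℕ_)
open import Data.List using (List; []; _∷_; _++_; map; concatMap; foldr)
open import Data.List.Properties using (≡-dec)
open import Data.Product using (_×_; _,_; Σ; ∃)
open import Relation.Nullary using (yes; no; Dec)
open import Relation.Binary.PropositionalEquality using (_≡_)

-- Letters of the free monoid.  The letter n : ℕ stands for the generator
-- u_{n+1}; thus the generators u_1, u_2, … correspond bijectively to ℕ.
Letter : Set
Letter = ℕ

-- u i is the letter of the generator u_i (only used for i ≥ 1).
u : ℕ → Letter
u i = pred i

Word : Set
Word = List Letter

_≟W_ : (v w : Word) → Dec (v ≡ w)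
_≟W_ = ≡-dec _≟ℕ_

-- The defining relations of J: RelGen l r means that l − r is one of the
-- listed generators of J.
data RelGen : Word → Word → Set where
  rel-comm : ∀ i j → 1 ≤ i → 1 ≤ j → 2 ≤ ∣ i - j ∣ →
    RelGen (u i ∷ u j ∷ []) (u j ∷ u i ∷ [])
  rel-2 : ∀ i → 1 ≤ i →
    RelGen (u i ∷ u (suc i) ∷ u i ∷ []) (u (suc i) ∷ u i ∷ u i ∷ [])
  rel-3 : ∀ i → 1 ≤ i →
    RelGen (u (suc i) ∷ u (suc i) ∷ u i ∷ []) (u (suc i) ∷ u i ∷ u (suc i) ∷ [])
  rel-4 : ∀ i → 1 ≤ i →
    RelGen (u (suc i) ∷ u (suc (suc i)) ∷ u (suc i) ∷ u i ∷ [])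
           (u (suc i) ∷ u (suc (suc i)) ∷ u i ∷ u (suc i) ∷ [])

module FreeAlg {c ℓ} (R : CommutativeRing c ℓ) where
  open CommutativeRing R

  -- A formal finite R-linear combination of words; it denotes an element of
  -- the free associative R-algebra R⟨u_1,u_2,…⟩.
  Poly : Set c
  Poly = List (Carrier × Word)

  coeff : Poly → Word → Carrier
  coeff [] w = 0#
  coeff ((a , v) ∷ p) w with v ≟W w
  ... | yes _ = a + coeff p w
  ... | no  _ = coeff p w

  _≋_ : Poly → Poly → Set ℓ
  p ≋ q = ∀ w → coeff p w ≈ coeff q w

  mono : Word → Poly
  mono w = (1# , w) ∷ []

  neg : Poly → Poly
  neg = map (λ { (a , w) → (- a , w) })

  _−_ : Poly → Poly → Poly
  p − q = p ++ neg q

  -- A basic element r · a (l − l') b of the two-sided ideal J, where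
  -- l − l' is a defining generator of J and a, b are words.
  record JTerm : Set c where
    constructor jterm
    field
      scalar : Carrier
      left right : Word
      lhs rhs : Word
      gen : RelGen lhs rhs

  jpoly : JTerm → Poly
  jpoly (jterm r a b l l' _) = (r , a ++ l ++ b) ∷ (- r , a ++ l' ++ b) ∷ []

  -- Membership in J: p is a finite sum of elements r · a g b with g a
  -- generator (every element x g y with x, y in the algebra expands to such a sum).
  InJ : Poly → Set (c ⊔ ℓ)
  InJ p = Σ (List JTerm) λ ts → p ≋ concatMap jpoly ts

  _≡_modJ : Poly → Poly → Set (c ⊔ ℓ)
  p ≡ q modJ = InJ (p − q)

module Submission where

-- Both congruences are obtained by rewriting words with the defining
-- relations of J, in the following steps.
--
-- 1. A rewriting step a·l·b ⟶ a·r·b (l − r a defining generator of J);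
--    _~_ is its equivalence closure, compatible with left multiplication.
-- 2. Congruence modulo J is an equivalence relation on formal linear
--    combinations (reflexivity: the empty sum of ideal elements; symmetry:
--    negate every scalar; transitivity: concatenate the sums), and a single
--    rewriting step is a basic element of J.  Hence v ~ w implies
--    v ≡ w (mod J).
-- 3. For letters A, B, C satisfying the relations that hold among three
--    consecutive generators u_i, u_{i+1}, u_{i+2} (the record Consecutive),
--    power versions of these relations give the word identities
--        B C^{m+1} B A ~ B C^{m+1} A B,     B C A^{m+1} B ~ C B A^{m+1} B.
-- 4. The theorem instantiates (3) at u_i, u_{i+1}, u_{i+2} with k = m + 1
--    and transfers the identities to J by (2).

open import Defs
open import Algebra.Bundles using (CommutativeRing)
open import Data.Nat using (ℕ; zero; suc; _≤_; z≤n; s≤s; ∣_-_∣)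
open import Data.List using ([]; _∷_; _++_; replicate; map; concatMap)
open import Data.List.Properties using (map-++; concatMap-++)
open import Data.Product using (_×_; _,_)
open import Relation.Nullary using (yes; no)
open import Relation.Binary.Core using (Rel)
open import Relation.Binary.Structures using (IsEquivalence)
open import Relation.Binary.PropositionalEquality as ≡ using (_≡_)
open import Relation.Binary.Construct.Closure.Equivalence as EqClosure
  using (EqClosure)
import Algebra.Properties.AbelianGroup as AbelianGroupProperties

infix 4 _⟶_ _~_
data _⟶_ : Word → Word → Set where
  apply : ∀ {l r} (a b : Word) → RelGen l r → (a ++ l ++ b) ⟶ (a ++ r ++ b)

_~_ : Rel Word _
_~_ = EqClosure _⟶_

relation : ∀ {l r} → RelGen l r → ∀ t → (l ++ t) ~ (r ++ t)
relation g t = EqClosure.return (apply [] t g)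

prefix : ∀ {v w} (x : Word) → v ~ w → (x ++ v) ~ (x ++ w)
prefix x = EqClosure.gmap (x ++_) (prefix-step x)
  where
  prefix-step : ∀ {v w} (x : Word) → v ⟶ w → (x ++ v) ⟶ (x ++ w)
  prefix-step []      s = s
  prefix-step (y ∷ x) s = cons-step (prefix-step x s)
    where
    cons-step : ∀ {v w} → v ⟶ w → (y ∷ v) ⟶ (y ∷ w)
    cons-step (apply a b g) = apply (y ∷ a) b g

module CongruenceModJ {c ℓ} (R : CommutativeRing c ℓ) where
  open CommutativeRing R
  open FreeAlg R
  open AbelianGroupProperties +-abelianGroup
    using (ε⁻¹≈ε; ⁻¹-∙-comm; ⁻¹-anti-homo‿-)
  open import Relation.Binary.Reasoning.Setoid setoid

  coeff-++ : ∀ p q w → coeff (p ++ q) w ≈ coeff p w + coeff q w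
  coeff-++ [] q w = sym (+-identityˡ _)
  coeff-++ ((a , v) ∷ p) q w with v ≟W w
  ... | yes _ = trans (+-congˡ (coeff-++ p q w)) (sym (+-assoc a _ _))
  ... | no  _ = coeff-++ p q w

  coeff-neg : ∀ p w → coeff (neg p) w ≈ - coeff p w
  coeff-neg [] w = sym ε⁻¹≈ε
  coeff-neg ((a , v) ∷ p) w with v ≟W w
  ... | yes _ = trans (+-congˡ (coeff-neg p w)) (⁻¹-∙-comm a (coeff p w))
  ... | no  _ = coeff-neg p w

  coeff-− : ∀ p q w → coeff (p − q) w ≈ coeff p w - coeff q w
  coeff-− p q w = trans (coeff-++ p (neg q) w) (+-congˡ (coeff-neg q w))

  telescope : ∀ a b d → (a - b) + (b - d) ≈ a - d
  telescope a b d = begin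
    (a - b) + (b - d)   ≈⟨ +-assoc a (- b) (b - d) ⟩
    a + (- b + (b - d)) ≈⟨ +-congˡ (+-assoc (- b) b (- d)) ⟨
    a + ((- b + b) - d) ≈⟨ +-congˡ (+-congʳ (-‿inverseˡ b)) ⟩
    a + (0# - d)        ≈⟨ +-congˡ (+-identityˡ (- d)) ⟩
    a - d               ∎

  negateTerm : JTerm → JTerm
  negateTerm (jterm r a b l l' g) = jterm (- r) a b l l' g

  jpolys-negate : ∀ ts → concatMap jpoly (map negateTerm ts) ≡ neg (concatMap jpoly ts)
  jpolys-negate [] = ≡.refl
  jpolys-negate (t ∷ ts) =
    ≡.trans (≡.cong (jpoly (negateTerm t) ++_) (jpolys-negate ts))
            (≡.sym (map-++ _ (jpoly t) (concatMap jpoly ts)))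

  modJ-refl : ∀ {p} → p ≡ p modJ
  modJ-refl {p} = [] , λ w → trans (coeff-− p p w) (-‿inverseʳ (coeff p w))

  modJ-sym : ∀ {p q} → p ≡ q modJ → q ≡ p modJ
  modJ-sym {p} {q} (ts , p−q∈J) = map negateTerm ts , λ w → begin
    coeff (q − p) w                              ≈⟨ coeff-− q p w ⟩
    coeff q w - coeff p w                        ≈⟨ ⁻¹-anti-homo‿- (coeff p w) (coeff q w) ⟨
    - (coeff p w - coeff q w)                    ≈⟨ -‿cong (trans (sym (coeff-− p q w)) (p−q∈J w)) ⟩
    - coeff (concatMap jpoly ts) w               ≈⟨ coeff-neg (concatMap jpoly ts) w ⟨
    coeff (neg (concatMap jpoly ts)) w           ≡⟨ ≡.cong (λ x → coeff x w) (jpolys-negate ts) ⟨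
    coeff (concatMap jpoly (map negateTerm ts)) w ∎

  modJ-trans : ∀ {p q r} → p ≡ q modJ → q ≡ r modJ → p ≡ r modJ
  modJ-trans {p} {q} {r} (ts , p−q∈J) (ts' , q−r∈J) = ts ++ ts' , λ w → begin
    coeff (p − r) w                                              ≈⟨ coeff-− p r w ⟩
    coeff p w - coeff r w                                        ≈⟨ telescope _ (coeff q w) _ ⟨
    (coeff p w - coeff q w) + (coeff q w - coeff r w)            ≈⟨ +-cong (trans (sym (coeff-− p q w)) (p−q∈J w))
                                                                           (trans (sym (coeff-− q r w)) (q−r∈J w)) ⟩
    coeff (concatMap jpoly ts) w + coeff (concatMap jpoly ts') w ≈⟨ coeff-++ (concatMap jpoly ts) _ w ⟨
    coeff (concatMap jpoly ts ++ concatMap jpoly ts') w          ≡⟨ ≡.cong (λ x → coeff x w) (concatMap-++ jpoly ts ts') ⟨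
    coeff (concatMap jpoly (ts ++ ts')) w                        ∎

  modJ-isEquivalence : IsEquivalence _≡_modJ
  modJ-isEquivalence = record
    { refl  = λ {p} → modJ-refl {p}
    ; sym   = λ {p} {q} → modJ-sym {p} {q}
    ; trans = λ {p} {q} {r} → modJ-trans {p} {q} {r}
    }

  step-sound : ∀ {v w} → v ⟶ w → mono v ≡ mono w modJ
  step-sound (apply {l} {r} a b g) = jterm 1# a b l r g ∷ [] , λ _ → refl

  sound : ∀ {v w} → v ~ w → mono v ≡ mono w modJ
  sound = EqClosure.gfold modJ-isEquivalence mono step-sound

infixr 8 _^_
_^_ : Letter → ℕ → Word
x ^ n = replicate n x

module _ where
  open import Relation.Binary.Reasoning.Setoid (EqClosure.setoid _⟶_)

  commute-power : ∀ {x y} → (∀ t → (x ∷ y ∷ t) ~ (y ∷ x ∷ t)) →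
    ∀ n t → (x ∷ y ^ n ++ t) ~ (y ^ n ++ x ∷ t)
  commute-power xy~yx zero    t = EqClosure.reflexive _⟶_
  commute-power {x} {y} xy~yx (suc n) t = begin
    x ∷ y ∷ y ^ n ++ t ≈⟨ xy~yx (y ^ n ++ t) ⟩
    y ∷ x ∷ y ^ n ++ t ≈⟨ prefix (y ∷ []) (commute-power xy~yx n t) ⟩
    y ∷ y ^ n ++ x ∷ t ∎

  power-yyx : ∀ {x y} → (∀ t → (y ∷ y ∷ x ∷ t) ~ (y ∷ x ∷ y ∷ t)) →
    ∀ m t → (y ^ suc m ++ x ∷ t) ~ (y ∷ x ∷ y ^ m ++ t)
  power-yyx yyx~yxy zero    t = EqClosure.reflexive _⟶_
  power-yyx {x} {y} yyx~yxy (suc m) t = begin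
    y ∷ y ^ suc m ++ x ∷ t   ≈⟨ prefix (y ∷ []) (power-yyx yyx~yxy m t) ⟩
    y ∷ y ∷ x ∷ y ^ m ++ t   ≈⟨ yyx~yxy (y ^ m ++ t) ⟩
    y ∷ x ∷ y ^ suc m ++ t   ∎

  power-yxx : ∀ {x y} → (∀ t → (x ∷ y ∷ x ∷ t) ~ (y ∷ x ∷ x ∷ t)) →
    ∀ m t → (y ∷ x ^ suc m ++ t) ~ (x ^ m ++ y ∷ x ∷ t)
  power-yxx xyx~yxx zero    t = EqClosure.reflexive _⟶_
  power-yxx {x} {y} xyx~yxx (suc m) t = begin
    y ∷ x ∷ x ^ suc m ++ t   ≈⟨ xyx~yxx (x ^ m ++ t) ⟨
    x ∷ y ∷ x ^ suc m ++ t   ≈⟨ prefix (x ∷ []) (power-yxx xyx~yxx m t) ⟩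
    x ∷ x ^ m ++ y ∷ x ∷ t   ∎

-- The defining relations holding among three consecutive generators
-- A = u_i, B = u_{i+1}, C = u_{i+2}, each in an arbitrary right context.
record Consecutive (A B C : Letter) : Set where
  field
    AC~CA     : ∀ t → (A ∷ C ∷ t) ~ (C ∷ A ∷ t)
    ABA~BAA   : ∀ t → (A ∷ B ∷ A ∷ t) ~ (B ∷ A ∷ A ∷ t)
    BCB~CBB   : ∀ t → (B ∷ C ∷ B ∷ t) ~ (C ∷ B ∷ B ∷ t)
    BBA~BAB   : ∀ t → (B ∷ B ∷ A ∷ t) ~ (B ∷ A ∷ B ∷ t)
    CCB~CBC   : ∀ t → (C ∷ C ∷ B ∷ t) ~ (C ∷ B ∷ C ∷ t)
    BCBA~BCAB : ∀ t → (B ∷ C ∷ B ∷ A ∷ t) ~ (B ∷ C ∷ A ∷ B ∷ t)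

module ConsecutiveIdentities {A B C : Letter} (rel : Consecutive A B C) where
  open Consecutive rel
  open import Relation.Binary.Reasoning.Setoid (EqClosure.setoid _⟶_)

  CA~AC : ∀ t → (C ∷ A ∷ t) ~ (A ∷ C ∷ t)
  CA~AC t = EqClosure.symmetric _⟶_ (AC~CA t)

  BCᵐ⁺¹BA~BCᵐ⁺¹AB : ∀ m t → (B ∷ C ^ suc m ++ B ∷ A ∷ t) ~ (B ∷ C ^ suc m ++ A ∷ B ∷ t)
  BCᵐ⁺¹BA~BCᵐ⁺¹AB m t = begin
    B ∷ C ^ suc m ++ B ∷ A ∷ t   ≈⟨ prefix (B ∷ []) (power-yyx CCB~CBC m (A ∷ t)) ⟩
    B ∷ C ∷ B ∷ C ^ m ++ A ∷ t   ≈⟨ prefix (B ∷ C ∷ B ∷ []) (commute-power AC~CA m t) ⟨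
    B ∷ C ∷ B ∷ A ∷ C ^ m ++ t   ≈⟨ BCBA~BCAB (C ^ m ++ t) ⟩
    B ∷ C ∷ A ∷ B ∷ C ^ m ++ t   ≈⟨ prefix (B ∷ []) (AC~CA (B ∷ C ^ m ++ t)) ⟨
    B ∷ A ∷ C ∷ B ∷ C ^ m ++ t   ≈⟨ prefix (B ∷ A ∷ []) (power-yyx CCB~CBC m t) ⟨
    B ∷ A ∷ C ^ suc m ++ B ∷ t   ≈⟨ prefix (B ∷ []) (commute-power AC~CA (suc m) (B ∷ t)) ⟩
    B ∷ C ^ suc m ++ A ∷ B ∷ t   ∎

  -- The case m = 0 of the second identity, shifted by one letter:
  -- B A C B ~ C B A B.
  BACB~CBAB : ∀ t → (B ∷ A ∷ C ∷ B ∷ t) ~ (C ∷ B ∷ A ∷ B ∷ t)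
  BACB~CBAB t = begin
    B ∷ A ∷ C ∷ B ∷ t   ≈⟨ prefix (B ∷ []) (AC~CA (B ∷ t)) ⟩
    B ∷ C ∷ A ∷ B ∷ t   ≈⟨ BCBA~BCAB t ⟨
    B ∷ C ∷ B ∷ A ∷ t   ≈⟨ BCB~CBB (A ∷ t) ⟩
    C ∷ B ∷ B ∷ A ∷ t   ≈⟨ prefix (C ∷ []) (BBA~BAB t) ⟩
    C ∷ B ∷ A ∷ B ∷ t   ∎

  BCAᵐ⁺¹B~CBAᵐ⁺¹B : ∀ m t → (B ∷ C ∷ A ^ suc m ++ B ∷ t) ~ (C ∷ B ∷ A ^ suc m ++ B ∷ t)
  BCAᵐ⁺¹B~CBAᵐ⁺¹B m t = begin
    B ∷ C ∷ A ^ suc m ++ B ∷ t       ≈⟨ prefix (B ∷ []) (commute-power CA~AC (suc m) (B ∷ t)) ⟩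
    B ∷ A ^ suc m ++ C ∷ B ∷ t       ≈⟨ power-yxx ABA~BAA m (C ∷ B ∷ t) ⟩
    A ^ m ++ B ∷ A ∷ C ∷ B ∷ t       ≈⟨ prefix (A ^ m) (BACB~CBAB t) ⟩
    A ^ m ++ C ∷ B ∷ A ∷ B ∷ t       ≈⟨ commute-power CA~AC m (B ∷ A ∷ B ∷ t) ⟨
    C ∷ A ^ m ++ B ∷ A ∷ B ∷ t       ≈⟨ prefix (C ∷ []) (power-yxx ABA~BAA m (B ∷ t)) ⟨
    C ∷ B ∷ A ^ suc m ++ B ∷ t       ∎

∣i-[i+2]∣≡2 : ∀ i → ∣ i - suc (suc i) ∣ ≡ 2
∣i-[i+2]∣≡2 zero    = ≡.refl
∣i-[i+2]∣≡2 (suc i) = ∣i-[i+2]∣≡2 i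

consecutive : ∀ i → 1 ≤ i → Consecutive (u i) (u (suc i)) (u (suc (suc i)))
consecutive i 1≤i = record
  { AC~CA     = relation (rel-comm i (suc (suc i)) 1≤i (s≤s z≤n) 2≤distance)
  ; ABA~BAA   = relation (rel-2 i 1≤i)
  ; BCB~CBB   = relation (rel-2 (suc i) (s≤s z≤n))
  ; BBA~BAB   = relation (rel-3 i 1≤i)
  ; CCB~CBC   = relation (rel-3 (suc i) (s≤s z≤n))
  ; BCBA~BCAB = relation (rel-4 i 1≤i)
  }
  where
  2≤distance : 2 ≤ ∣ i - suc (suc i) ∣
  2≤distance = ≡.subst (2 ≤_) (≡.sym (∣i-[i+2]∣≡2 i)) (s≤s (s≤s z≤n))

-- Imported only here: inside CongruenceModJ it would clash with the ring's _+_.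
open import Data.Nat using (_+_)
open import Data.Nat.Properties using (+-comm)

mainTheorem11 : ∀ {c ℓ} (R : CommutativeRing c ℓ) (i k : ℕ) → 1 ≤ i → 1 ≤ k →
    let open FreeAlg R in
    (mono (u (i + 1) ∷ replicate k (u (i + 2)) ++ u (i + 1) ∷ u i ∷ [])
    ≡ mono (u (i + 1) ∷ replicate k (u (i + 2)) ++ u i ∷ u (i + 1) ∷ []) modJ)
    × (mono (u (i + 1) ∷ u (i + 2) ∷ replicate k (u i) ++ u (i + 1) ∷ [])
    ≡ mono (u (i + 2) ∷ u (i + 1) ∷ replicate k (u i) ++ u (i + 1) ∷ []) modJ)
mainTheorem11 R i (suc m) 1≤i _ rewrite +-comm i 1 | +-comm i 2 =
  sound (BCᵐ⁺¹BA~BCᵐ⁺¹AB m []) , sound (BCAᵐ⁺¹B~CBAᵐ⁺¹B m [])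
  where
  open CongruenceModJ R using (sound)
  open ConsecutiveIdentities (consecutive i 1≤i)
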